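{- Let $p,q$ be optimization terms built only from atomic terms, $nil$, restriction and parallel composition, and let $x$ be a name with $x\notin fn(q)$. Then $\mathrm{cost}((x)p\parallel q)\leq\mathrm{cost}((x)(p\parallel q))$.
   Context: Names: an enumerable set $\mathcal{N}$. Atomic problems: a set $C$ with arity $ar$, including $nil$. Terms considered: $p,q::=p\parallel q\mid(x)p\mid A(\tilde x)\mid nil$ with $|\tilde x|=ar(A)$, where restriction binds tighter than $\parallel$ (so $(x)p\parallel q$ means $((x)p)\parallel q$). Free names: $fn(p\parallel q)=fn(p)\cup fn(q)$, $fn((x)p)=fn(p)\setminus\{x\}$, $fn(A(\tilde x))=\tilde x$ (as a set), $fn(nil)=\emptyset$. Complexity: $\mathrm{cost}(A(\tilde x))=|\tilde x|$, $\mathrm{cost}(nil)=0$, $\mathrm{cost}((x)p)=\mathrm{cost}(p)$, $\mathrm{cost}(p\parallel q)=\max\{\mathrm{cost}(p),\mathrm{cost}(q),|fn(p\parallel q)|\}$. -}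

module Defs where

open import Data.Nat using (ℕ; _⊔_; _≟_)
open import Data.List using (List; []; _∷_; _++_; filter; deduplicate; length)
open import Data.Vec using (Vec; toList)
open import Data.List.Membership.Propositional using (_∉_)
open import Relation.Nullary using (¬?)
open import Function using (_∘_)

Name : Set
Name = ℕ

-- Optimization terms over a set C of atomic problems with arity ar.
-- (The atomic problem nil ∈ C is represented by the constructor `nil`.)
module Terms (C : Set) (ar : C → ℕ) where

  data Term : Set where
    _∥_  : Term → Term → Term
    ν    : Name → Term → Term            -- ν x p  is  (x)p
    atom : (A : C) → Vec Name (ar A) → Term
    nil  : Term

  infixr 5 _∥_

  -- free names, as a list (read as a set)
  fn : Term → List Name
  fn (p ∥ q)    = fn p ++ fn q
  fn (ν x p)    = filter (¬? ∘ (x ≟_)) (fn p)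
  fn (atom A xs) = toList xs
  fn nil        = []

  #fn : Term → ℕ
  #fn p = length (deduplicate _≟_ (fn p))

  cost : Term → ℕ
  cost (p ∥ q)     = cost p ⊔ cost q ⊔ #fn (p ∥ q)
  cost (ν x p)     = cost p
  cost (atom A xs) = ar A
  cost nil         = 0

-- Restricting x removes x from the free names of p; since x is not free in q,
-- the free names of (x)p ∥ q are those of p ∥ q with x filtered out. Filtering
-- commutes with deduplication and can only shorten a list, so #fn does not grow,
-- while the remaining components of the two costs coincide.
module Submission where

open import Defs
open import Data.Nat using (ℕ; _≤_; _⊔_; _≟_)
open import Data.Nat.Properties using (⊔-monoʳ-≤; ≤-reflexive; ≤-trans; module ≤-Reasoning)
open import Data.Product using (_,_; proj₂; swap)
open import Data.List using (List; []; _∷_; _++_; filter; deduplicate; length)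
open import Data.List.Properties using (filter-all; filter-++; length-filter; filter-≐)
open import Data.List.Relation.Unary.All.Properties using (¬Any⇒All¬)
open import Data.List.Membership.Propositional using (_∉_)
open import Relation.Nullary using (¬_; ¬?; yes; no)
open import Relation.Unary using (Pred; Decidable; _⊆_)
open import Relation.Unary.Properties using (_∩?_)
open import Relation.Binary.Definitions using (DecidableEquality)
open import Relation.Binary.PropositionalEquality using (_≡_; _≗_; refl; sym; trans; cong; module ≡-Reasoning)
open import Function using (_∘_)
open import Level using (Level)

private
  variable
    a p q : Level
    A : Set a

filter-filter : {P : Pred A p} {Q : Pred A q} (P? : Decidable P) (Q? : Decidable Q) →
                filter P? ∘ filter Q? ≗ filter (Q? ∩? P?)
filter-filter P? Q? [] = refl
filter-filter P? Q? (y ∷ ys) with Q? y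
... | no  _ = filter-filter P? Q? ys
... | yes _ with P? y
...   | yes _ = cong (y ∷_) (filter-filter P? Q? ys)
...   | no  _ = filter-filter P? Q? ys

module _ {P : Pred A p} {Q : Pred A q} (P? : Decidable P) (Q? : Decidable Q) where

  filter-comm : filter P? ∘ filter Q? ≗ filter Q? ∘ filter P?
  filter-comm ys = trans (filter-filter P? Q? ys)
    (trans (filter-≐ (Q? ∩? P?) (P? ∩? Q?) (swap , swap) ys) (sym (filter-filter Q? P? ys)))

  filter-absorbˡ : P ⊆ Q → filter P? ∘ filter Q? ≗ filter P?
  filter-absorbˡ P⊆Q ys = trans (filter-filter P? Q? ys)
    (filter-≐ (Q? ∩? P?) P? (proj₂ , λ pz → P⊆Q pz , pz) ys)

module _ (_≟_ : DecidableEquality A) where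

  private
    dedup : List A → List A
    dedup = deduplicate _≟_

  deduplicate-filter : {P : Pred A p} (P? : Decidable P) →
                       dedup ∘ filter P? ≗ filter P? ∘ dedup
  deduplicate-filter P? [] = refl
  deduplicate-filter {P = P} P? (y ∷ ys) with P? y
  ... | yes _ = cong (y ∷_) (trans (cong (filter (¬? ∘ (y ≟_))) (deduplicate-filter P? ys))
                                   (filter-comm (¬? ∘ (y ≟_)) P? (dedup ys)))
  ... | no ¬Py = trans (deduplicate-filter P? ys)
                       (sym (filter-absorbˡ P? (¬? ∘ (y ≟_)) y≢ (dedup ys)))
    where
    y≢ : ∀ {z} → P z → ¬ y ≡ z
    y≢ Pz refl = ¬Py Pz

  length-deduplicate-filter : {P : Pred A p} (P? : Decidable P) (ys : List A) →
                              length (dedup (filter P? ys)) ≤ length (dedup ys)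
  length-deduplicate-filter P? ys = ≤-trans
    (≤-reflexive (cong length (deduplicate-filter P? ys)))
    (length-filter P? (dedup ys))

module _ {C : Set} {ar : C → ℕ} where

  open Terms C ar

  fn-ν-∥ : ∀ x p q → x ∉ fn q → fn (ν x p ∥ q) ≡ filter (¬? ∘ (x ≟_)) (fn (p ∥ q))
  fn-ν-∥ x p q x∉q = begin
    filter x≢? (fn p) ++ fn q
      ≡⟨ cong (filter x≢? (fn p) ++_) (sym (filter-all x≢? (¬Any⇒All¬ (fn q) x∉q))) ⟩
    filter x≢? (fn p) ++ filter x≢? (fn q)
      ≡⟨ sym (filter-++ x≢? (fn p) (fn q)) ⟩
    filter x≢? (fn p ++ fn q) ∎
    where
    open ≡-Reasoning
    x≢? : Decidable (λ y → ¬ x ≡ y)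
    x≢? = ¬? ∘ (x ≟_)

lemma2 : (C : Set) (ar : C → ℕ) (p q : Terms.Term C ar) (x : Name) →
         x ∉ Terms.fn C ar q →
         Terms.cost C ar (Terms._∥_ (Terms.ν x p) q) ≤ Terms.cost C ar (Terms.ν x (Terms._∥_ p q))
lemma2 C ar p q x x∉q = ⊔-monoʳ-≤ (cost p ⊔ cost q) (begin
  #fn (ν x p ∥ q)
    ≡⟨ cong (length ∘ deduplicate _≟_) (fn-ν-∥ x p q x∉q) ⟩
  length (deduplicate _≟_ (filter (¬? ∘ (x ≟_)) (fn (p ∥ q))))
    ≤⟨ length-deduplicate-filter _≟_ (¬? ∘ (x ≟_)) (fn (p ∥ q)) ⟩
  #fn (p ∥ q) ∎)
  where
  open Terms C ar
  open ≤-Reasoning
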